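{- Let $b > i \ge 0$ be two integers and let $n \ge b$. Let $([n],R)$ be a set system (with $[n]=\{1,\dots,n\}$ and $R$ a set of subsets of $[n]$) such that $f_R(b) < \upsilon_i(b)$, where $\upsilon_i(b) = 2^i(b-i+1)$. Then \[ |R| = f_R(n) < \sum_{j=0}^{i} (b-j+1)\binom{n}{j}. \]
   Context: For a set system $([n],R)$ and $X\subseteq[n]$, the trace of $R$ on $X$ is $R_{|X}=\{A\cap X \mid A\in R\}$. The shatter function is $f_R(b)=\max_{X\subseteq[n],\,|X|=b} |R_{|X}|$ for $0\le b\le n$. Convention: $\binom{n}{ -1}=0$. -}

module Defs where

open import Data.Nat using (ℕ; zero; suc; _+_; _*_; _∸_; _^_; _⊔_)
open import Data.Nat.Combinatorics using (_C_)
open import Data.Bool using (Bool; true; false)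
import Data.Bool.Properties as BoolP
open import Data.Vec using (Vec; []; _∷_)
open import Data.Vec.Properties using (≡-dec)
open import Data.Fin.Subset using (Subset; _∩_; ∣_∣)
open import Data.List using (List; []; _∷_; [_]; map; _++_; length; deduplicate; foldr; filter; upTo)
open import Data.Nat.ListAction using (sum)
open import Data.Nat.Properties using (_≟_)
open import Relation.Binary.PropositionalEquality using (_≡_)
open import Relation.Binary.Definitions using (DecidableEquality)

_≟ˢ_ : ∀ {n} → DecidableEquality (Subset n)
_≟ˢ_ = ≡-dec BoolP._≟_

-- A set system R on [n] is a duplicate-free list of subsets (see Statement: Unique R).
-- |R| is its length.

trace : ∀ {n} → List (Subset n) → Subset n → List (Subset n)
trace R X = deduplicate _≟ˢ_ (map (λ A → A ∩ X) R)

allSubsets : (n : ℕ) → List (Subset n)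
allSubsets zero = [ [] ]
allSubsets (suc n) = map (true ∷_) (allSubsets n) ++ map (false ∷_) (allSubsets n)

maximum : List ℕ → ℕ
maximum = foldr _⊔_ 0

shatter : ∀ {n} → List (Subset n) → ℕ → ℕ
shatter {n} R b =
  maximum (map (λ X → length (trace R X)) (filter (λ X → ∣ X ∣ ≟ b) (allSubsets n)))

υ : ℕ → ℕ → ℕ
υ i b = 2 ^ i * (b ∸ i + 1)

bound : ℕ → ℕ → ℕ → ℕ
bound n b i = sum (map (λ j → (b ∸ j + 1) * (n C j)) (upTo (suc i)))

-- Split R along the first point into its projection R′ onto the other points
-- and the family R″ of sets A with both A and {1} ∪ A in R; then |R| = |R′| + |R″|. A trace of R′
-- on b points is a trace of R, and the trace of R on {1} ∪ Y has at least
-- |R′|_Y| + |R″|_Y| ≥ 2 |R″|_Y| elements, so f_R′(b) < υ_i(b) and f_R″(b-1) < υ_{i-1}(b-1),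
-- since υ_i(b) = 2 υ_{i-1}(b-1). The bound obeys the matching Pascal recursion. The base cases
-- are i = 0, Bondy's theorem f_R(b) ≤ b ⇒ |R| ≤ b, and n = b, where |R| = f_R(b) < υ_i(b) and
-- υ_i(b) ≤ Σ_{j≤i} (b-j+1) C(b,j) by the same recursion.
module Submission where

open import Defs
open import Data.Bool as Bool using (Bool; true; false; _∧_; _∨_; T; if_then_else_)
open import Data.Bool.Properties using (T-∧; T-∨; ∧-zeroʳ; ∧-identityʳ; ∧-idem; ∨-identityʳ)
open import Data.Empty using (⊥-elim)
open import Data.Fin using (Fin; zero; suc)
open import Data.Fin.Subset using (Subset; _∩_; ∣_∣; ⊤; ⊥)
open import Data.Fin.Subset.Properties using (∣⊥∣≡0; ∣⊤∣≡n; ∩-assoc; ∩-idem; ∩-identityʳ)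
open import Data.List using (List; []; _∷_; length; map; filter; deduplicate; applyUpTo)
open import Data.List.Membership.Propositional using (_∈_; find)
open import Data.List.Membership.Propositional.Properties
  using (∈-map⁺; ∈-map⁻; ∈-filter⁺; ∈-filter⁻; ∈-deduplicate⁺; ∈-deduplicate⁻; ∈-++⁺ˡ; ∈-++⁺ʳ)
open import Data.List.Properties using (filter-notAll; length-map; length-deduplicate; map-∘; map-cong; map-id)
open import Data.List.Relation.Binary.Subset.Propositional using (_⊆_)
open import Data.List.Relation.Unary.All as All using (All)
open import Data.List.Relation.Unary.Any as Any using (Any; here; there; any?)
open import Data.List.Relation.Unary.Unique.Propositional using (Unique; []; _∷_)
open import Data.List.Relation.Unary.Unique.DecPropositional.Properties using (deduplicate-!)
open import Data.Nat using (ℕ; zero; suc; _+_; _*_; _∸_; _^_; _⊓_; _≤_; _<_; z≤n; s≤s)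
open import Data.Nat.Combinatorics using (_C_; nCk+nC[k+1]≡[n+1]C[k+1])
open import Data.Nat.ListAction using (sum)
open import Data.Nat.Properties
open import Data.Product using (∃; ∃₂; _×_; _,_; proj₁; proj₂)
open import Data.Sum as Sum using (_⊎_; inj₁; inj₂)
open import Data.Unit using (tt)
open import Data.Vec using ([]; _∷_; lookup; _[_]≔_)
open import Data.Vec.Properties using (∷-injectiveˡ; ∷-injectiveʳ)
open import Function using (_∘_; Equivalence)
open import Relation.Binary.Definitions using (DecidableEquality)
open import Relation.Binary.PropositionalEquality
open import Relation.Nullary using (Dec; yes; no; does; ¬_; ¬?; contradiction)
open import Relation.Nullary.Decidable using (_×-dec_; T?)
open import Algebra.Properties.CommutativeSemigroup +-commutativeSemigroup using () renaming (interchange to +-interchange)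

open Equivalence using (to; from)

private
  variable
    n : ℕ

does-sound : ∀ {a} {P : Set a} (P? : Dec P) → T (does P?) → P
does-sound (yes p) _ = p

does-complete : ∀ {a} {P : Set a} (P? : Dec P) → P → T (does P?)
does-complete (yes _) _ = tt
does-complete (no ¬p) p = ¬p p

-- A set system on [n] is handled through its characteristic function, so that splitting it
-- along the first point is definitional and sizes are counts over the cube.
Family : ℕ → Set
Family n = Subset n → Bool

slice : Bool → Family (suc n) → Family n
slice a p A = p (a ∷ A)

anyˢ : Family n → Bool
anyˢ {zero}  p = p []
anyˢ {suc n} p = anyˢ (slice true p) ∨ anyˢ (slice false p)

countˢ : Family n → ℕ
countˢ {zero}  p = if p [] then 1 else 0
countˢ {suc n} p = countˢ (slice true p) + countˢ (slice false p)

_⊆ᶠ_ : Family n → Family n → Set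
p ⊆ᶠ q = ∀ A → T (p A) → T (q A)

_∪ᶠ_ _∩ᶠ_ : Family n → Family n → Family n
(p ∪ᶠ q) A = p A ∨ q A
(p ∩ᶠ q) A = p A ∧ q A

module _ (p q : Family n) (A : Subset n) where

  ∪ᶠ-intro : T (p A) ⊎ T (q A) → T ((p ∪ᶠ q) A)
  ∪ᶠ-intro = from T-∨

  ∪ᶠ-elim : T ((p ∪ᶠ q) A) → T (p A) ⊎ T (q A)
  ∪ᶠ-elim = to T-∨

  ∩ᶠ-intro : T (p A) × T (q A) → T ((p ∩ᶠ q) A)
  ∩ᶠ-intro = from T-∧

  ∩ᶠ-elim : T ((p ∩ᶠ q) A) → T (p A) × T (q A)
  ∩ᶠ-elim = to T-∧

anyˢ-intro : (p : Family n) (A : Subset n) → T (p A) → T (anyˢ p)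
anyˢ-intro {zero}  p []          t = t
anyˢ-intro {suc n} p (true ∷ A)  t = from T-∨ (inj₁ (anyˢ-intro _ A t))
anyˢ-intro {suc n} p (false ∷ A) t = from T-∨ (inj₂ (anyˢ-intro _ A t))

anyˢ-elim : (p : Family n) → T (anyˢ p) → ∃ λ A → T (p A)
anyˢ-elim {zero}  p t = [] , t
anyˢ-elim {suc n} p t with to T-∨ t
... | inj₁ t₁ = let A , pA = anyˢ-elim _ t₁ in true ∷ A , pA
... | inj₂ t₀ = let A , pA = anyˢ-elim _ t₀ in false ∷ A , pA

anyˢ-false : (p : Family n) → (∀ A → p A ≡ false) → anyˢ p ≡ false
anyˢ-false {zero}  p p≡false = p≡false []
anyˢ-false {suc n} p p≡false =
  cong₂ _∨_ (anyˢ-false _ (λ A → p≡false (true ∷ A))) (anyˢ-false _ (λ A → p≡false (false ∷ A)))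

countˢ-cong : {p q : Family n} → (∀ A → p A ≡ q A) → countˢ p ≡ countˢ q
countˢ-cong {zero}  p≡q = cong (λ a → if a then 1 else 0) (p≡q [])
countˢ-cong {suc n} p≡q = cong₂ _+_ (countˢ-cong (p≡q ∘ (true ∷_))) (countˢ-cong (p≡q ∘ (false ∷_)))

countˢ-mono : {p q : Family n} → p ⊆ᶠ q → countˢ p ≤ countˢ q
countˢ-mono {zero} {p} {q} p⊆q with p [] | q [] | p⊆q []
... | false | _     | _ = z≤n
... | true  | true  | _ = ≤-refl
... | true  | false | f = ⊥-elim (f tt)
countˢ-mono {suc n} p⊆q = +-mono-≤ (countˢ-mono (p⊆q ∘ (true ∷_))) (countˢ-mono (p⊆q ∘ (false ∷_)))

countˢ-ext : {p q : Family n} → p ⊆ᶠ q → q ⊆ᶠ p → countˢ p ≡ countˢ q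
countˢ-ext p⊆q q⊆p = ≤-antisym (countˢ-mono p⊆q) (countˢ-mono q⊆p)

countˢ-empty : (p : Family n) → (∀ A → ¬ T (p A)) → countˢ p ≡ 0
countˢ-empty {zero} p ¬p with p [] | ¬p []
... | false | _ = refl
... | true  | f = ⊥-elim (f tt)
countˢ-empty {suc n} p ¬p =
  cong₂ _+_ (countˢ-empty _ (λ A → ¬p (true ∷ A))) (countˢ-empty _ (λ A → ¬p (false ∷ A)))

countˢ-singleton : (p : Family n) (u : Subset n) → T (p u) → (∀ A → T (p A) → A ≡ u) → countˢ p ≡ 1
countˢ-singleton {zero} p [] pu _ with p []
... | true = refl
countˢ-singleton {suc n} p (true ∷ u) pu only-u =
  cong₂ _+_ (countˢ-singleton _ u pu (λ A → ∷-injectiveʳ ∘ only-u (true ∷ A)))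
            (countˢ-empty _ (λ A → (λ ()) ∘ ∷-injectiveˡ ∘ only-u (false ∷ A)))
countˢ-singleton {suc n} p (false ∷ u) pu only-u =
  cong₂ _+_ (countˢ-empty _ (λ A → (λ ()) ∘ ∷-injectiveˡ ∘ only-u (true ∷ A)))
            (countˢ-singleton _ u pu (λ A → ∷-injectiveʳ ∘ only-u (false ∷ A)))

countˢ-∪-∩ : (p q : Family n) → countˢ (p ∪ᶠ q) + countˢ (p ∩ᶠ q) ≡ countˢ p + countˢ q
countˢ-∪-∩ {zero} p q with p [] | q []
... | true  | true  = refl
... | true  | false = refl
... | false | true  = refl
... | false | false = refl
countˢ-∪-∩ {suc n} p q = begin
  (countˢ (p₁ ∪ᶠ q₁) + countˢ (p₀ ∪ᶠ q₀)) + (countˢ (p₁ ∩ᶠ q₁) + countˢ (p₀ ∩ᶠ q₀))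
    ≡⟨ +-interchange (countˢ (p₁ ∪ᶠ q₁)) _ _ _ ⟩
  (countˢ (p₁ ∪ᶠ q₁) + countˢ (p₁ ∩ᶠ q₁)) + (countˢ (p₀ ∪ᶠ q₀) + countˢ (p₀ ∩ᶠ q₀))
    ≡⟨ cong₂ _+_ (countˢ-∪-∩ p₁ q₁) (countˢ-∪-∩ p₀ q₀) ⟩
  (countˢ p₁ + countˢ q₁) + (countˢ p₀ + countˢ q₀)
    ≡⟨ +-interchange (countˢ p₁) _ _ _ ⟩
  (countˢ p₁ + countˢ p₀) + (countˢ q₁ + countˢ q₀) ∎
  where
  open ≡-Reasoning
  p₁ p₀ q₁ q₀ : Family n
  p₁ = slice true p
  p₀ = slice false p
  q₁ = slice true q
  q₀ = slice false q

countˢ-∪-disjoint : (p q : Family n) → (∀ A → ¬ T ((p ∩ᶠ q) A)) →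
  countˢ (p ∪ᶠ q) ≡ countˢ p + countˢ q
countˢ-∪-disjoint p q disjoint = begin
  countˢ (p ∪ᶠ q)                     ≡⟨ +-identityʳ _ ⟨
  countˢ (p ∪ᶠ q) + 0                 ≡⟨ cong (countˢ (p ∪ᶠ q) +_) (countˢ-empty (p ∩ᶠ q) disjoint) ⟨
  countˢ (p ∪ᶠ q) + countˢ (p ∩ᶠ q)   ≡⟨ countˢ-∪-∩ p q ⟩
  countˢ p + countˢ q                 ∎
  where open ≡-Reasoning

module Distinct {a} {A : Set a} (_≟_ : DecidableEquality A) where

  card : List A → ℕ
  card xs = length (deduplicate _≟_ xs)

  length-mono-⊆ : {xs ys : List A} → Unique xs → xs ⊆ ys → length xs ≤ length ys
  length-mono-⊆ [] _ = z≤n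
  length-mono-⊆ {x ∷ xs} {ys} (x∉xs ∷ xs!) x∷xs⊆ys =
    ≤-trans (s≤s (length-mono-⊆ xs! xs⊆ys-x)) (filter-notAll (λ y → ¬? (x ≟ y)) ys x∈ys)
    where
    xs⊆ys-x : xs ⊆ filter (λ y → ¬? (x ≟ y)) ys
    xs⊆ys-x y∈xs = ∈-filter⁺ (λ y → ¬? (x ≟ y)) (x∷xs⊆ys (there y∈xs)) (All.lookup x∉xs y∈xs)
    x∈ys : Any (λ y → ¬ ¬ x ≡ y) ys
    x∈ys = Any.map (λ x≡y x≢y → x≢y x≡y) (x∷xs⊆ys (here refl))

  card-mono-⊆ : {xs ys : List A} → xs ⊆ ys → card xs ≤ card ys
  card-mono-⊆ {xs} xs⊆ys =
    length-mono-⊆ (deduplicate-! _≟_ xs) (∈-deduplicate⁺ _≟_ ∘ xs⊆ys ∘ ∈-deduplicate⁻ _≟_ xs)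

  card-unique : {xs : List A} → Unique xs → card xs ≡ length xs
  card-unique {xs} xs! = ≤-antisym (length-deduplicate _≟_ xs) (length-mono-⊆ xs! (∈-deduplicate⁺ _≟_))

  card≤length : (xs : List A) → card xs ≤ length xs
  card≤length = length-deduplicate _≟_

  card-map-≤ : (f : A → A) (xs : List A) → card (map f xs) ≤ card xs
  card-map-≤ f xs = begin
    card (map f xs)                       ≤⟨ card-mono-⊆ image⊆ ⟩
    card (map f (deduplicate _≟_ xs))     ≤⟨ card≤length (map f (deduplicate _≟_ xs)) ⟩
    length (map f (deduplicate _≟_ xs))   ≡⟨ length-map f (deduplicate _≟_ xs) ⟩
    card xs                               ∎
    where
    open ≤-Reasoning
    image⊆ : map f xs ⊆ map f (deduplicate _≟_ xs)
    image⊆ fx∈ with ∈-map⁻ f fx∈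
    ... | x , x∈xs , refl = ∈-map⁺ f (∈-deduplicate⁺ _≟_ x∈xs)

  card-filter-≢-< : {x : A} (xs : List A) → x ∈ xs → card (filter (λ y → ¬? (x ≟ y)) xs) < card xs
  card-filter-≢-< {x} xs x∈xs = begin-strict
    card (filter x≢? xs)                      ≤⟨ length-mono-⊆ (deduplicate-! _≟_ (filter x≢? xs)) sub ⟩
    length (filter x≢? (deduplicate _≟_ xs))  <⟨ filter-notAll x≢? (deduplicate _≟_ xs) x∈ ⟩
    card xs                                   ∎
    where
    open ≤-Reasoning
    x≢? = λ y → ¬? (x ≟ y)
    x∈ : Any (λ y → ¬ ¬ x ≡ y) (deduplicate _≟_ xs)
    x∈ = Any.map (λ x≡y x≢y → x≢y x≡y) (∈-deduplicate⁺ _≟_ x∈xs)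
    sub : deduplicate _≟_ (filter x≢? xs) ⊆ filter x≢? (deduplicate _≟_ xs)
    sub y∈ with ∈-filter⁻ x≢? {xs = xs} (∈-deduplicate⁻ _≟_ (filter x≢? xs) y∈)
    ... | y∈xs , x≢y = ∈-filter⁺ x≢? (∈-deduplicate⁺ _≟_ y∈xs) x≢y

  Collision : (A → A) → List A → Set a
  Collision f xs = ∃₂ λ x y → x ∈ xs × y ∈ xs × x ≢ y × f x ≡ f y

  InjectiveOn : (A → A) → List A → Set a
  InjectiveOn f xs = ∀ {x y} → x ∈ xs → y ∈ xs → f x ≡ f y → x ≡ y

  collision-or-injective : (f : A → A) (xs : List A) → Collision f xs ⊎ InjectiveOn f xs
  collision-or-injective f xs with any? (λ x → any? (λ y → ¬? (x ≟ y) ×-dec (f x ≟ f y)) xs) xs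
  ... | yes c =
    let x , x∈xs , c′ = find c
        y , y∈xs , x≢y , fx≡fy = find c′
    in inj₁ (x , y , x∈xs , y∈xs , x≢y , fx≡fy)
  ... | no ¬c = inj₂ injective
    where
    injective : InjectiveOn f xs
    injective {x} {y} x∈xs y∈xs fx≡fy with x ≟ y
    ... | yes x≡y = x≡y
    ... | no  x≢y = contradiction (Any.map (λ { refl → Any.map (λ { refl → x≢y , fx≡fy }) y∈xs }) x∈xs) ¬c

  card-map-< : (f : A → A) (xs : List A) → Collision f xs → card (map f xs) < card xs
  card-map-< f xs (x , y , x∈xs , y∈xs , x≢y , fx≡fy) = begin-strict
    card (map f xs)              ≤⟨ card-mono-⊆ image⊆ ⟩
    card (map f (filter y≢? xs)) ≤⟨ card-map-≤ f (filter y≢? xs) ⟩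
    card (filter y≢? xs)         <⟨ card-filter-≢-< xs y∈xs ⟩
    card xs                      ∎
    where
    open ≤-Reasoning
    y≢? = λ z → ¬? (y ≟ z)
    image⊆ : map f xs ⊆ map f (filter y≢? xs)
    image⊆ fz∈ with ∈-map⁻ f fz∈
    ... | z , z∈xs , refl with y ≟ z
    ...   | yes refl = subst (_∈ map f (filter y≢? xs)) fx≡fy
                         (∈-map⁺ f (∈-filter⁺ y≢? x∈xs (x≢y ∘ sym)))
    ...   | no  y≢z  = ∈-map⁺ f (∈-filter⁺ y≢? z∈xs y≢z)

  map-unique : (f : A → A) {xs : List A} → Unique xs → InjectiveOn f xs → Unique (map f xs)
  map-unique f [] _ = []
  map-unique f {x ∷ xs} (x∉xs ∷ xs!) inj =
    All.tabulate fx≢ ∷ map-unique f xs! (λ y∈ z∈ → inj (there y∈) (there z∈))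
    where
    fx≢ : ∀ {z} → z ∈ map f xs → f x ≢ z
    fx≢ z∈ fx≡z with ∈-map⁻ f z∈
    ... | y , y∈xs , refl = All.lookup x∉xs y∈xs (inj (here refl) (there y∈xs) fx≡z)

  card-map-injective : (f : A → A) (xs : List A) → InjectiveOn f xs → card xs ≤ card (map f xs)
  card-map-injective f xs inj = begin
    card xs                          ≡⟨ length-map f (deduplicate _≟_ xs) ⟨
    length (map f (deduplicate _≟_ xs))
      ≤⟨ length-mono-⊆ (map-unique f (deduplicate-! _≟_ xs) inj′) image⊆ ⟩
    card (map f xs)                  ∎
    where
    open ≤-Reasoning
    inj′ : InjectiveOn f (deduplicate _≟_ xs)
    inj′ x∈ y∈ = inj (∈-deduplicate⁻ _≟_ xs x∈) (∈-deduplicate⁻ _≟_ xs y∈)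
    image⊆ : map f (deduplicate _≟_ xs) ⊆ deduplicate _≟_ (map f xs)
    image⊆ fx∈ with ∈-map⁻ f fx∈
    ... | x , x∈ , refl = ∈-deduplicate⁺ _≟_ (∈-map⁺ f (∈-deduplicate⁻ _≟_ xs x∈))

open module SubsetDistinct {n} = Distinct (_≟ˢ_ {n})

⟦_⟧ : List (Subset n) → Family n
⟦ L ⟧ A = does (any? (A ≟ˢ_) L)

⟦⟧-sound : (L : List (Subset n)) {A : Subset n} → T (⟦ L ⟧ A) → A ∈ L
⟦⟧-sound L {A} = does-sound (any? (A ≟ˢ_) L)

⟦⟧-complete : (L : List (Subset n)) {A : Subset n} → A ∈ L → T (⟦ L ⟧ A)
⟦⟧-complete L {A} = does-complete (any? (A ≟ˢ_) L)

countˢ-⟦⟧-unique : {U : List (Subset n)} → Unique U → countˢ ⟦ U ⟧ ≡ length U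
countˢ-⟦⟧-unique {n} {U = []} [] = countˢ-empty {n} ⟦ [] ⟧ (λ _ ())
countˢ-⟦⟧-unique {U = u ∷ U} (u∉U ∷ U!) = begin
  countˢ ⟦ u ∷ U ⟧                 ≡⟨ countˢ-ext split join ⟩
  countˢ (⟦ u ∷ [] ⟧ ∪ᶠ ⟦ U ⟧)     ≡⟨ countˢ-∪-disjoint ⟦ u ∷ [] ⟧ ⟦ U ⟧ disjoint ⟩
  countˢ ⟦ u ∷ [] ⟧ + countˢ ⟦ U ⟧ ≡⟨ cong₂ _+_ single (countˢ-⟦⟧-unique U!) ⟩
  suc (length U)                   ∎
  where
  open ≡-Reasoning
  only-u : ∀ A → T (⟦ u ∷ [] ⟧ A) → A ≡ u
  only-u A t with ⟦⟧-sound (u ∷ []) t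
  ... | here A≡u = A≡u
  split : ⟦ u ∷ U ⟧ ⊆ᶠ (⟦ u ∷ [] ⟧ ∪ᶠ ⟦ U ⟧)
  split A t with ⟦⟧-sound (u ∷ U) t
  ... | here A≡u  = ∪ᶠ-intro ⟦ u ∷ [] ⟧ ⟦ U ⟧ A (inj₁ (⟦⟧-complete (u ∷ []) (here A≡u)))
  ... | there A∈U = ∪ᶠ-intro ⟦ u ∷ [] ⟧ ⟦ U ⟧ A (inj₂ (⟦⟧-complete U A∈U))
  join : (⟦ u ∷ [] ⟧ ∪ᶠ ⟦ U ⟧) ⊆ᶠ ⟦ u ∷ U ⟧
  join A t with ∪ᶠ-elim ⟦ u ∷ [] ⟧ ⟦ U ⟧ A t
  ... | inj₁ t₁ = ⟦⟧-complete (u ∷ U) (here (only-u A t₁))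
  ... | inj₂ t₀ = ⟦⟧-complete (u ∷ U) (there (⟦⟧-sound U t₀))
  disjoint : ∀ A → ¬ T ((⟦ u ∷ [] ⟧ ∩ᶠ ⟦ U ⟧) A)
  disjoint A t with ∩ᶠ-elim ⟦ u ∷ [] ⟧ ⟦ U ⟧ A t
  ... | t₁ , t₀ with only-u A t₁
  ...   | refl = All.lookup u∉U (⟦⟧-sound U t₀) refl
  single : countˢ ⟦ u ∷ [] ⟧ ≡ 1
  single = countˢ-singleton ⟦ u ∷ [] ⟧ u (⟦⟧-complete (u ∷ []) (here refl)) only-u

countˢ-⟦⟧ : (L : List (Subset n)) → countˢ ⟦ L ⟧ ≡ card L
countˢ-⟦⟧ L = trans
  (countˢ-ext (λ A → ⟦⟧-complete (deduplicate _≟ˢ_ L) ∘ ∈-deduplicate⁺ _≟ˢ_ ∘ ⟦⟧-sound L {A})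
              (λ A → ⟦⟧-complete L ∘ ∈-deduplicate⁻ _≟ˢ_ L ∘ ⟦⟧-sound (deduplicate _≟ˢ_ L) {A}))
  (countˢ-⟦⟧-unique (deduplicate-! _≟ˢ_ L))

traceᶠ : Family n → Subset n → Family n
traceᶠ r X B = anyˢ (λ A → r A ∧ does ((A ∩ X) ≟ˢ B))

traceᶠ-intro : (r : Family n) (X : Subset n) {B : Subset n} (A : Subset n) →
  T (r A) → A ∩ X ≡ B → T (traceᶠ r X B)
traceᶠ-intro r X {B} A rA A∩X≡B =
  anyˢ-intro _ A (∩ᶠ-intro r (λ A → does ((A ∩ X) ≟ˢ B)) A (rA , does-complete ((A ∩ X) ≟ˢ B) A∩X≡B))

traceᶠ-elim : (r : Family n) (X B : Subset n) → T (traceᶠ r X B) → ∃ λ A → T (r A) × A ∩ X ≡ B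
traceᶠ-elim r X B t with anyˢ-elim _ t
... | A , t′ with ∩ᶠ-elim r (λ A → does ((A ∩ X) ≟ˢ B)) A t′
...   | rA , eq = A , rA , does-sound ((A ∩ X) ≟ˢ B) eq

traceᶠ-mono : {r s : Family n} (X : Subset n) → r ⊆ᶠ s → traceᶠ r X ⊆ᶠ traceᶠ s X
traceᶠ-mono {r = r} {s} X r⊆s B t with traceᶠ-elim r X B t
... | A , rA , A∩X≡B = traceᶠ-intro s X A (r⊆s A rA) A∩X≡B

traceᶠ-∪ : (r s : Family n) (X : Subset n) → traceᶠ (r ∪ᶠ s) X ⊆ᶠ (traceᶠ r X ∪ᶠ traceᶠ s X)
traceᶠ-∪ r s X B t with traceᶠ-elim (r ∪ᶠ s) X B t
... | A , t′ , A∩X≡B = ∪ᶠ-intro (traceᶠ r X) (traceᶠ s X) B (Sum.map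
  (λ rA → traceᶠ-intro r X A rA A∩X≡B) (λ sA → traceᶠ-intro s X A sA A∩X≡B) (∪ᶠ-elim r s A t′))

traceᶠ-∩ : (r s : Family n) (X : Subset n) → traceᶠ (r ∩ᶠ s) X ⊆ᶠ (traceᶠ r X ∩ᶠ traceᶠ s X)
traceᶠ-∩ r s X B t = ∩ᶠ-intro (traceᶠ r X) (traceᶠ s X) B
  ( traceᶠ-mono X (λ A → proj₁ ∘ ∩ᶠ-elim r s A) B t
  , traceᶠ-mono X (λ A → proj₂ ∘ ∩ᶠ-elim r s A) B t )

countˢ-traceᶠ-⊤ : (r : Family n) → countˢ (traceᶠ r ⊤) ≡ countˢ r
countˢ-traceᶠ-⊤ r = countˢ-ext trace⊆r r⊆trace
  where
  trace⊆r : traceᶠ r ⊤ ⊆ᶠ r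
  trace⊆r B t with traceᶠ-elim r ⊤ B t
  ... | A , rA , A∩⊤≡B = subst (T ∘ r) (trans (sym (∩-identityʳ A)) A∩⊤≡B) rA
  r⊆trace : r ⊆ᶠ traceᶠ r ⊤
  r⊆trace A rA = traceᶠ-intro r ⊤ A rA (∩-identityʳ A)

countˢ-traceᶠ-⟦⟧ : (L : List (Subset n)) (X : Subset n) → countˢ (traceᶠ ⟦ L ⟧ X) ≡ length (trace L X)
countˢ-traceᶠ-⟦⟧ L X = trans (countˢ-ext trace⊆image image⊆trace) (countˢ-⟦⟧ (map (_∩ X) L))
  where
  trace⊆image : traceᶠ ⟦ L ⟧ X ⊆ᶠ ⟦ map (_∩ X) L ⟧
  trace⊆image B t with traceᶠ-elim ⟦ L ⟧ X B t
  ... | A , A∈L , refl = ⟦⟧-complete (map (_∩ X) L) (∈-map⁺ (_∩ X) (⟦⟧-sound L A∈L))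
  image⊆trace : ⟦ map (_∩ X) L ⟧ ⊆ᶠ traceᶠ ⟦ L ⟧ X
  image⊆trace B t with ∈-map⁻ (_∩ X) (⟦⟧-sound (map (_∩ X) L) t)
  ... | A , A∈L , refl = traceᶠ-intro ⟦ L ⟧ X A (⟦⟧-complete L A∈L) refl

-- Splitting off the first point

projection doubled : Family (suc n) → Family n
projection r = slice true r ∪ᶠ slice false r
doubled    r = slice true r ∩ᶠ slice false r

countˢ-projection-doubled : (r : Family (suc n)) → countˢ r ≡ countˢ (projection r) + countˢ (doubled r)
countˢ-projection-doubled r = sym (countˢ-∪-∩ (slice true r) (slice false r))

traceᶠ-true∷ : (r : Family (suc n)) (Y : Subset n) (a : Bool) (B : Subset n) →
  traceᶠ r (true ∷ Y) (a ∷ B) ≡ traceᶠ (slice a r) Y B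
traceᶠ-true∷ r Y true B =
  trans (cong (traceᶠ (slice true r) Y B ∨_) (anyˢ-false _ (λ A → ∧-zeroʳ (r (false ∷ A)))))
        (∨-identityʳ _)
traceᶠ-true∷ r Y false B =
  cong (_∨ traceᶠ (slice false r) Y B) (anyˢ-false _ (λ A → ∧-zeroʳ (r (true ∷ A))))

countˢ-traceᶠ-projection : (r : Family (suc n)) (Y : Subset n) →
  countˢ (traceᶠ (projection r) Y) ≤ countˢ (traceᶠ r (false ∷ Y))
countˢ-traceᶠ-projection r Y = begin
  countˢ (traceᶠ (projection r) Y)
    ≤⟨ countˢ-mono (traceᶠ-∪ (slice true r) (slice false r) Y) ⟩
  countˢ (traceᶠ (slice true r) Y ∪ᶠ traceᶠ (slice false r) Y)
    ≤⟨ m≤n+m _ _ ⟩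
  countˢ (traceᶠ r (false ∷ Y)) ∎
  where open ≤-Reasoning

countˢ-traceᶠ-doubled : (r : Family (suc n)) (Y : Subset n) →
  2 * countˢ (traceᶠ (doubled r) Y) ≤ countˢ (traceᶠ r (true ∷ Y))
countˢ-traceᶠ-doubled r Y = begin
  2 * d
    ≡⟨ cong (d +_) (+-identityʳ d) ⟩
  d + d
    ≤⟨ +-monoˡ-≤ d (countˢ-mono (traceᶠ-mono Y doubled⊆projection)) ⟩
  countˢ (traceᶠ (projection r) Y) + d
    ≤⟨ +-mono-≤ (countˢ-mono (traceᶠ-∪ r₁ r₀ Y)) (countˢ-mono (traceᶠ-∩ r₁ r₀ Y)) ⟩
  countˢ (t₁ ∪ᶠ t₀) + countˢ (t₁ ∩ᶠ t₀)
    ≡⟨ countˢ-∪-∩ t₁ t₀ ⟩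
  countˢ t₁ + countˢ t₀
    ≡⟨ cong₂ _+_ (countˢ-cong (traceᶠ-true∷ r Y true)) (countˢ-cong (traceᶠ-true∷ r Y false)) ⟨
  countˢ (traceᶠ r (true ∷ Y)) ∎
  where
  open ≤-Reasoning
  r₁ r₀ t₁ t₀ : Family _
  r₁ = slice true r
  r₀ = slice false r
  t₁ = traceᶠ r₁ Y
  t₀ = traceᶠ r₀ Y
  d = countˢ (traceᶠ (doubled r) Y)
  doubled⊆projection : doubled r ⊆ᶠ projection r
  doubled⊆projection A = ∪ᶠ-intro r₁ r₀ A ∘ inj₁ ∘ proj₁ ∘ ∩ᶠ-elim r₁ r₀ A

-- Bondy's theorem

free-coordinate : (X : Subset n) → ∣ X ∣ < n → ∃ λ x → lookup X x ≡ false
free-coordinate (false ∷ X) _ = zero , refl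
free-coordinate (true ∷ X) (s≤s |X|<n) = let x , x∉X = free-coordinate X |X|<n in suc x , x∉X

∣[]≔true∣ : (X : Subset n) (x : Fin n) → lookup X x ≡ false → ∣ X [ x ]≔ true ∣ ≡ suc ∣ X ∣
∣[]≔true∣ (false ∷ X) zero    _   = refl
∣[]≔true∣ (true ∷ X)  (suc x) x∉X = cong suc (∣[]≔true∣ X x x∉X)
∣[]≔true∣ (false ∷ X) (suc x) x∉X = ∣[]≔true∣ X x x∉X

[]≔true-∩ : (X : Subset n) (x : Fin n) → (X [ x ]≔ true) ∩ X ≡ X
[]≔true-∩ (c ∷ X) zero    = cong (c ∷_) (∩-idem X)
[]≔true-∩ (c ∷ X) (suc x) = cong₂ _∷_ (∧-idem c) ([]≔true-∩ X x)

∩-[]≔true-∩ : (A X : Subset n) (x : Fin n) → (A ∩ (X [ x ]≔ true)) ∩ X ≡ A ∩ X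
∩-[]≔true-∩ A X x = trans (∩-assoc A _ X) (cong (A ∩_) ([]≔true-∩ X x))

∧-true-injective : ∀ {a b} → a ∧ true ≡ b ∧ true → a ≡ b
∧-true-injective {a} {b} eq = trans (sym (∧-identityʳ a)) (trans eq (∧-identityʳ b))

separating-coordinate : (A B X : Subset n) → A ≢ B → A ∩ X ≡ B ∩ X →
  ∃ λ x → lookup X x ≡ false × A ∩ (X [ x ]≔ true) ≢ B ∩ (X [ x ]≔ true)
separating-coordinate [] [] [] A≢B _ = ⊥-elim (A≢B refl)
separating-coordinate (a ∷ A) (b ∷ B) (c ∷ X) a∷A≢b∷B eq with a Bool.≟ b
... | yes refl =
  let x , x∉X , sep = separating-coordinate A B X (a∷A≢b∷B ∘ cong (a ∷_)) (∷-injectiveʳ eq)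
  in suc x , x∉X , sep ∘ ∷-injectiveʳ
... | no a≢b with c
...   | true  = ⊥-elim (a≢b (∧-true-injective (∷-injectiveˡ eq)))
...   | false = zero , refl , a≢b ∘ ∧-true-injective ∘ ∷-injectiveˡ

⊓-suc-≤ : ∀ m b → m ⊓ suc b ≤ b → m ≤ b
⊓-suc-≤ zero    b       _       = z≤n
⊓-suc-≤ (suc m) zero    ()
⊓-suc-≤ (suc m) (suc b) (s≤s h) = s≤s (⊓-suc-≤ m b h)

card⊓1≤length-trace : (L : List (Subset n)) (X : Subset n) → card L ⊓ 1 ≤ length (trace L X)
card⊓1≤length-trace []      X = z≤n
card⊓1≤length-trace (_ ∷ _) X = ≤-trans (m⊓n≤n _ 1) (s≤s z≤n)

module _ (L : List (Subset n)) where

  private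
    trace-[]≔true : (X : Subset n) (x : Fin n) → map (_∩ X) (map (_∩ (X [ x ]≔ true)) L) ≡ map (_∩ X) L
    trace-[]≔true X x = trans (sym (map-∘ L)) (map-cong (λ A → ∩-[]≔true-∩ A X x) L)

    length-trace-≤ : (X : Subset n) (x : Fin n) → length (trace L X) ≤ length (trace L (X [ x ]≔ true))
    length-trace-≤ X x = subst (_≤ length (trace L (X [ x ]≔ true))) (cong card (trace-[]≔true X x))
      (card-map-≤ (_∩ X) (map (_∩ (X [ x ]≔ true)) L))

    length-trace-< : (X : Subset n) (x : Fin n) → Collision (_∩ X) (map (_∩ (X [ x ]≔ true)) L) →
      length (trace L X) < length (trace L (X [ x ]≔ true))
    length-trace-< X x c = subst (_< length (trace L (X [ x ]≔ true))) (cong card (trace-[]≔true X x))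
      (card-map-< (_∩ X) (map (_∩ (X [ x ]≔ true)) L) c)

  -- X grows by a point that separates two sets of L with equal traces on X, if there are such
  -- sets; otherwise all of L is already separated by X.
  large-trace : ∀ k → k ≤ n → ∃ λ X → ∣ X ∣ ≡ k × card L ⊓ suc k ≤ length (trace L X)
  large-trace zero _ = ⊥ , ∣⊥∣≡0 n , card⊓1≤length-trace L ⊥
  large-trace (suc k) k<n with large-trace k (<⇒≤ k<n)
  ... | X , refl , big with collision-or-injective (_∩ X) L
  ...   | inj₁ (A , B , A∈L , B∈L , A≢B , eq) =
    let x , x∉X , sep = separating-coordinate A B X A≢B eq
        X′ = X [ x ]≔ true
        eq′ = trans (∩-[]≔true-∩ A X x) (trans eq (sym (∩-[]≔true-∩ B X x)))
        c = A ∩ X′ , B ∩ X′ , ∈-map⁺ (_∩ X′) A∈L , ∈-map⁺ (_∩ X′) B∈L , sep , eq′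
    in X′ , ∣[]≔true∣ X x x∉X ,
       ≤-trans (⊓-monoˡ-≤ (suc (suc k)) (n≤1+n (card L))) (≤-trans (s≤s big) (length-trace-< X x c))
  ...   | inj₂ injective =
    let x , x∉X = free-coordinate X k<n
    in X [ x ]≔ true , ∣[]≔true∣ X x x∉X ,
       ≤-trans (m⊓n≤m _ _) (≤-trans (card-map-injective (_∩ X) L injective) (length-trace-≤ X x))

  bondy-list : ∀ b → b ≤ n → (∀ X → ∣ X ∣ ≡ b → length (trace L X) ≤ b) → card L ≤ b
  bondy-list b b≤n small with large-trace b b≤n
  ... | X , |X| , big = ⊓-suc-≤ (card L) b (≤-trans big (small X |X|))

allSubsets-complete : (A : Subset n) → A ∈ allSubsets n
allSubsets-complete [] = here refl
allSubsets-complete {suc n} (true ∷ A)  = ∈-++⁺ˡ (∈-map⁺ (true ∷_) (allSubsets-complete A))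
allSubsets-complete {suc n} (false ∷ A) =
  ∈-++⁺ʳ (map (true ∷_) (allSubsets n)) (∈-map⁺ (false ∷_) (allSubsets-complete A))

members : Family n → List (Subset n)
members {n} r = filter (λ A → T? (r A)) (allSubsets n)

bondy : (r : Family n) (b : ℕ) → b ≤ n →
  (∀ X → ∣ X ∣ ≡ b → countˢ (traceᶠ r X) ≤ b) → countˢ r ≤ b
bondy {n} r b b≤n small = begin
  countˢ r               ≡⟨ countˢ-ext r⊆⟦L⟧ ⟦L⟧⊆r ⟩
  countˢ ⟦ L ⟧           ≡⟨ countˢ-⟦⟧ L ⟩
  card L                 ≤⟨ bondy-list L b b≤n small′ ⟩
  b                      ∎
  where
  open ≤-Reasoning
  L = members r
  ⟦L⟧⊆r : ⟦ L ⟧ ⊆ᶠ r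
  ⟦L⟧⊆r A = proj₂ ∘ ∈-filter⁻ (λ A → T? (r A)) {xs = allSubsets n} ∘ ⟦⟧-sound L
  r⊆⟦L⟧ : r ⊆ᶠ ⟦ L ⟧
  r⊆⟦L⟧ A = ⟦⟧-complete L ∘ ∈-filter⁺ (λ A → T? (r A)) (allSubsets-complete A)
  small′ : ∀ X → ∣ X ∣ ≡ b → length (trace L X) ≤ b
  small′ X |X| = begin
    length (trace L X)       ≡⟨ countˢ-traceᶠ-⟦⟧ L X ⟨
    countˢ (traceᶠ ⟦ L ⟧ X)  ≡⟨ countˢ-ext (traceᶠ-mono X ⟦L⟧⊆r) (traceᶠ-mono X r⊆⟦L⟧) ⟩
    countˢ (traceᶠ r X)      ≤⟨ small X |X| ⟩
    b                        ∎

-- The binomial bound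

∑< : ℕ → (ℕ → ℕ) → ℕ
∑< zero    f = 0
∑< (suc k) f = f 0 + ∑< k (f ∘ suc)

sum-map-applyUpTo : (f g : ℕ → ℕ) (k : ℕ) → sum (map f (applyUpTo g k)) ≡ ∑< k (f ∘ g)
sum-map-applyUpTo f g zero    = refl
sum-map-applyUpTo f g (suc k) = cong (f (g 0) +_) (sum-map-applyUpTo f (g ∘ suc) k)

∑<-cong : {f g : ℕ → ℕ} (k : ℕ) → (∀ j → f j ≡ g j) → ∑< k f ≡ ∑< k g
∑<-cong zero    _   = refl
∑<-cong (suc k) f≡g = cong₂ _+_ (f≡g 0) (∑<-cong k (f≡g ∘ suc))

∑<-+ : (f g : ℕ → ℕ) (k : ℕ) → ∑< k (λ j → f j + g j) ≡ ∑< k f + ∑< k g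
∑<-+ f g zero    = refl
∑<-+ f g (suc k) = trans (cong (f 0 + g 0 +_) (∑<-+ (f ∘ suc) (g ∘ suc) k))
                         (+-interchange (f 0) (g 0) _ _)

∑<-mono : {f g : ℕ → ℕ} (k : ℕ) → (∀ j → f j ≤ g j) → ∑< k f ≤ ∑< k g
∑<-mono zero    _   = z≤n
∑<-mono (suc k) f≤g = +-mono-≤ (f≤g 0) (∑<-mono k (f≤g ∘ suc))

∑<-≤-suc : (f : ℕ → ℕ) (k : ℕ) → ∑< k f ≤ ∑< (suc k) f
∑<-≤-suc f zero    = z≤n
∑<-≤-suc f (suc k) = +-monoʳ-≤ (f 0) (∑<-≤-suc (f ∘ suc) k)

∑<-pascal : (w : ℕ → ℕ) (n k : ℕ) →
  ∑< (suc k) (λ j → w j * (suc n C j)) ≡ ∑< (suc k) (λ j → w j * (n C j)) + ∑< k (λ j → w (suc j) * (n C j))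
∑<-pascal w n k = begin
  w 0 * 1 + ∑< k (λ j → w (suc j) * (suc n C suc j))
    ≡⟨ cong (w 0 * 1 +_) (∑<-cong k split) ⟩
  w 0 * 1 + ∑< k (λ j → w (suc j) * (n C suc j) + w (suc j) * (n C j))
    ≡⟨ cong (w 0 * 1 +_) (∑<-+ (λ j → w (suc j) * (n C suc j)) (λ j → w (suc j) * (n C j)) k) ⟩
  w 0 * 1 + (∑< k (λ j → w (suc j) * (n C suc j)) + ∑< k (λ j → w (suc j) * (n C j)))
    ≡⟨ +-assoc (w 0 * 1) _ _ ⟨
  ∑< (suc k) (λ j → w j * (n C j)) + ∑< k (λ j → w (suc j) * (n C j)) ∎
  where
  open ≡-Reasoning
  split : ∀ j → w (suc j) * (suc n C suc j) ≡ w (suc j) * (n C suc j) + w (suc j) * (n C j)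
  split j = begin
    w (suc j) * (suc n C suc j)                       ≡⟨ cong (w (suc j) *_) (nCk+nC[k+1]≡[n+1]C[k+1] n j) ⟨
    w (suc j) * (n C j + n C suc j)                   ≡⟨ cong (w (suc j) *_) (+-comm (n C j) (n C suc j)) ⟩
    w (suc j) * (n C suc j + n C j)                   ≡⟨ *-distribˡ-+ (w (suc j)) (n C suc j) (n C j) ⟩
    w (suc j) * (n C suc j) + w (suc j) * (n C j)     ∎

bound≡∑< : (n b i : ℕ) → bound n b i ≡ ∑< (suc i) (λ j → (b ∸ j + 1) * (n C j))
bound≡∑< n b i = sum-map-applyUpTo (λ j → (b ∸ j + 1) * (n C j)) (λ j → j) (suc i)

bound-zero : (n b : ℕ) → bound n b 0 ≡ suc b
bound-zero n b = trans (bound≡∑< n b 0) (trans (+-identityʳ _) (trans (*-identityʳ (b + 1)) (+-comm b 1)))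

-- The weight b ∸ j + 1 of the j-th term drops by one when b and j both grow by one.
bound-pascal : (n b i : ℕ) → bound (suc n) (suc b) (suc i) ≡ bound n (suc b) (suc i) + bound n b i
bound-pascal n b i = begin
  bound (suc n) (suc b) (suc i)                    ≡⟨ bound≡∑< (suc n) (suc b) (suc i) ⟩
  ∑< (suc (suc i)) (λ j → w j * (suc n C j))       ≡⟨ ∑<-pascal w n (suc i) ⟩
  ∑< (suc (suc i)) (λ j → w j * (n C j)) + ∑< (suc i) (λ j → w (suc j) * (n C j))
                                                   ≡⟨ cong₂ _+_ (bound≡∑< n (suc b) (suc i)) (bound≡∑< n b i) ⟨
  bound n (suc b) (suc i) + bound n b i            ∎
  where
  open ≡-Reasoning
  w : ℕ → ℕ
  w j = suc b ∸ j + 1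

bound-≤-suc : (n b i : ℕ) → bound n b i ≤ bound n (suc b) (suc i)
bound-≤-suc n b i = begin
  bound n b i                                          ≡⟨ bound≡∑< n b i ⟩
  ∑< (suc i) (λ j → (b ∸ j + 1) * (n C j))             ≤⟨ ∑<-mono (suc i) weight-≤ ⟩
  ∑< (suc i) (λ j → (suc b ∸ j + 1) * (n C j))         ≤⟨ ∑<-≤-suc (λ j → (suc b ∸ j + 1) * (n C j)) (suc i) ⟩
  ∑< (suc (suc i)) (λ j → (suc b ∸ j + 1) * (n C j))   ≡⟨ bound≡∑< n (suc b) (suc i) ⟨
  bound n (suc b) (suc i)                              ∎
  where
  open ≤-Reasoning
  weight-≤ : ∀ j → (b ∸ j + 1) * (n C j) ≤ (suc b ∸ j + 1) * (n C j)
  weight-≤ j = *-monoˡ-≤ (n C j) (+-monoˡ-≤ 1 (∸-monoˡ-≤ j (n≤1+n b)))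

υ-zero : (b : ℕ) → υ 0 b ≡ suc b
υ-zero b = trans (*-identityˡ (b + 1)) (+-comm b 1)

υ-suc : (i b : ℕ) → υ (suc i) (suc b) ≡ 2 * υ i b
υ-suc i b = *-assoc 2 (2 ^ i) (b ∸ i + 1)

υ≤bound : (i b : ℕ) → i ≤ b → υ i b ≤ bound b b i
υ≤bound zero    b       _       = ≤-reflexive (trans (υ-zero b) (sym (bound-zero b b)))
υ≤bound (suc i) (suc b) (s≤s i≤b) = begin
  υ (suc i) (suc b)                          ≡⟨ υ-suc i b ⟩
  υ i b + (υ i b + 0)                        ≤⟨ +-mono-≤ (≤-trans ih (bound-≤-suc b b i)) (+-monoˡ-≤ 0 ih) ⟩
  bound b (suc b) (suc i) + (bound b b i + 0) ≡⟨ cong (bound b (suc b) (suc i) +_) (+-identityʳ _) ⟩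
  bound b (suc b) (suc i) + bound b b i      ≡⟨ bound-pascal b b i ⟨
  bound (suc b) (suc b) (suc i)              ∎
  where
  open ≤-Reasoning
  ih = υ≤bound i b i≤b

countˢ-<-bound : (n b i : ℕ) (r : Family n) → i < b → b ≤ n →
  (∀ X → ∣ X ∣ ≡ b → countˢ (traceᶠ r X) < υ i b) → countˢ r < bound n b i
countˢ-<-bound n b zero r _ b≤n small =
  subst (countˢ r <_) (sym (bound-zero n b))
    (s≤s (bondy r b b≤n (λ X |X| → ≤-pred (subst (countˢ (traceᶠ r X) <_) (υ-zero b) (small X |X|)))))
countˢ-<-bound n (suc b) (suc i) r (s≤s i<b) b≤n small with m≤n⇒m<n∨m≡n b≤n
... | inj₂ refl = begin-strict
  countˢ r                     ≡⟨ countˢ-traceᶠ-⊤ r ⟨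
  countˢ (traceᶠ r ⊤)          <⟨ small ⊤ (∣⊤∣≡n n) ⟩
  υ (suc i) n                  ≤⟨ υ≤bound (suc i) n (s≤s (<⇒≤ i<b)) ⟩
  bound n n (suc i)            ∎
  where open ≤-Reasoning
countˢ-<-bound (suc m) (suc b) (suc i) r (s≤s i<b) _ small | inj₁ (s≤s b<m) = begin-strict
  countˢ r                                          ≡⟨ countˢ-projection-doubled r ⟩
  countˢ (projection r) + countˢ (doubled r)        <⟨ +-mono-< projection-bound doubled-bound ⟩
  bound m (suc b) (suc i) + bound m b i             ≡⟨ bound-pascal m b i ⟨
  bound (suc m) (suc b) (suc i)                     ∎
  where
  open ≤-Reasoning
  projection-bound : countˢ (projection r) < bound m (suc b) (suc i)
  projection-bound = countˢ-<-bound m (suc b) (suc i) (projection r) (s≤s i<b) b<m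
    (λ Y |Y| → ≤-<-trans (countˢ-traceᶠ-projection r Y) (small (false ∷ Y) |Y|))
  doubled-bound : countˢ (doubled r) < bound m b i
  doubled-bound = countˢ-<-bound m b i (doubled r) i<b (≤-trans (n≤1+n b) b<m)
    (λ Y |Y| → *-cancelˡ-< 2 _ _ (begin-strict
      2 * countˢ (traceᶠ (doubled r) Y)  ≤⟨ countˢ-traceᶠ-doubled r Y ⟩
      countˢ (traceᶠ r (true ∷ Y))       <⟨ small (true ∷ Y) (cong suc |Y|) ⟩
      υ (suc i) (suc b)                  ≡⟨ υ-suc i b ⟩
      2 * υ i b                          ∎))

maximum-upper : {x : ℕ} (xs : List ℕ) → x ∈ xs → x ≤ maximum xs
maximum-upper (y ∷ xs) (here refl) = m≤m⊔n y (maximum xs)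
maximum-upper (y ∷ xs) (there x∈) = ≤-trans (maximum-upper xs x∈) (m≤n⊔m y (maximum xs))

maximum-least : (c : ℕ) (xs : List ℕ) → (∀ {x} → x ∈ xs → x ≤ c) → maximum xs ≤ c
maximum-least c []       _   = z≤n
maximum-least c (y ∷ xs) ≤c = ⊔-lub (≤c (here refl)) (maximum-least c xs (≤c ∘ there))

length-trace≤shatter : (R : List (Subset n)) {b : ℕ} (X : Subset n) → ∣ X ∣ ≡ b →
  length (trace R X) ≤ shatter R b
length-trace≤shatter {n} R {b} X |X| = maximum-upper _
  (∈-map⁺ (λ X → length (trace R X)) (∈-filter⁺ (λ X → ∣ X ∣ ≟ b) (allSubsets-complete X) |X|))

shatter-full : (R : List (Subset n)) → Unique R → length R ≡ shatter R n
shatter-full {n} R R! = ≤-antisym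
  (subst (_≤ shatter R n) trace-⊤ (length-trace≤shatter R ⊤ (∣⊤∣≡n n)))
  (maximum-least (length R) _ trace≤length)
  where
  trace-⊤ : length (trace R ⊤) ≡ length R
  trace-⊤ = trans (cong card (trans (map-cong ∩-identityʳ R) (map-id R))) (card-unique R!)
  trace≤length : ∀ {t} → t ∈ map (λ X → length (trace R X)) (filter (λ X → ∣ X ∣ ≟ n) (allSubsets n)) →
    t ≤ length R
  trace≤length t∈ with ∈-map⁻ (λ X → length (trace R X)) t∈
  ... | X , _ , refl = ≤-trans (card≤length (map (_∩ X) R)) (≤-reflexive (length-map (_∩ X) R))

theorem1 : (b i n : ℕ) → i < b → b ≤ n → (R : List (Subset n)) → Unique R →
    shatter R b < υ i b →
    (length R ≡ shatter R n) × (length R < bound n b i)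
theorem1 b i n i<b b≤n R R! small = shatter-full R R! , (begin-strict
  length R       ≡⟨ countˢ-⟦⟧-unique R! ⟨
  countˢ ⟦ R ⟧   <⟨ countˢ-<-bound n b i ⟦ R ⟧ i<b b≤n small-traces ⟩
  bound n b i    ∎)
  where
  open ≤-Reasoning
  small-traces : ∀ X → ∣ X ∣ ≡ b → countˢ (traceᶠ ⟦ R ⟧ X) < υ i b
  small-traces X |X| = begin-strict
    countˢ (traceᶠ ⟦ R ⟧ X)  ≡⟨ countˢ-traceᶠ-⟦⟧ R X ⟩
    length (trace R X)       ≤⟨ length-trace≤shatter R X |X| ⟩
    shatter R b              <⟨ small ⟩
    υ i b                    ∎
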